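{- There is a deterministic online algorithm for the generalized $k$-server problem in the uniform metric case whose competitive ratio is $O(k 2^k)$.
   Context: Generalized $k$-server problem: there are $k$ servers $s_1,\dots,s_k$, where server $s_i$ lies in its own metric space $M_i$ with distance $d_i$. Requests arrive online; a request is a $k$-tuple $r=(r_1,\dots,r_k)$ with $r_i\in M_i$, and to serve it the algorithm must move servers so that $s_i$ is at $r_i$ for at least one $i\in[k]$. The cost is the total distance traveled by all servers. Uniform metric case: every $M_i$ is a finite uniform metric space (the $M_i$ may have different numbers of points) in which all pairwise distances equal $1$; thus moving from configuration $q$ to $q'$ costs the Hamming distance $|\{i: q_i\neq q'_i\}|$. A deterministic online algorithm is $c$-competitive if there is a constant $a$ (independent of the request sequence) such that for every request sequence $\sigma$ (and common initial configuration), $\mathrm{cost}_{\mathrm{ALG}}(\sigma)\le c\cdot \mathrm{OPT}(\sigma)+a$, where $\mathrm{OPT}(\sigma)$ is the minimum cost of an offline solution. -}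

module Defs where

open import Data.Nat using (ℕ; _+_; _*_; _≤_)
open import Data.Fin using (Fin; zero; suc)
open import Data.Fin.Properties using (_≟_)
open import Data.List using (List; []; _∷_)
open import Data.List.Relation.Binary.Pointwise using (Pointwise)
open import Data.Product using (∃; Σ; _×_)
open import Data.Vec.Functional.Properties using ()
open import Relation.Binary.PropositionalEquality using (_≡_)
open import Relation.Nullary using (Dec; yes; no)

-- Uniform-metric generalized k-server instance: k servers, server i lives in
-- the uniform metric space with n i points, represented as Fin (n i).

Config : (k : ℕ) → (Fin k → ℕ) → Set
Config k n = (i : Fin k) → Fin (n i)

Request : (k : ℕ) → (Fin k → ℕ) → Set
Request = Config

Serves : ∀ {k n} → Config k n → Request k n → Set
Serves {k} q r = ∃ λ (i : Fin k) → q i ≡ r i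

diffCount : ∀ {k n} → Config k n → Config k n → ℕ
diffCount {ℕ.zero} q q' = 0
diffCount {ℕ.suc k} {n} q q' =
  here (q zero ≟ q' zero) + diffCount {k} {λ i → n (suc i)} (λ i → q (suc i)) (λ i → q' (suc i))
  where
  here : ∀ {A : Set} → Dec A → ℕ
  here (yes _) = 0
  here (no _)  = 1

-- Uniform metric: moving from q to q' costs the Hamming distance.
hamming : ∀ {k n} → Config k n → Config k n → ℕ
hamming = diffCount

-- A deterministic online algorithm: given the initial configuration, the
-- history of earlier requests (most recent first) and the current request,
-- it outputs its next configuration. (Its state is a function of this data.)
OnlineAlg : (k : ℕ) → (Fin k → ℕ) → Set
OnlineAlg k n = Config k n → List (Request k n) → Request k n → Config k n

ValidAlg : ∀ {k n} → OnlineAlg k n → Set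
ValidAlg {k} {n} alg =
  (q₀ : Config k n) (hist : List (Request k n)) (r : Request k n) → Serves (alg q₀ hist r) r

algCostFrom : ∀ {k n} → OnlineAlg k n → Config k n → List (Request k n) →
              Config k n → List (Request k n) → ℕ
algCostFrom alg q₀ hist cur [] = 0
algCostFrom alg q₀ hist cur (r ∷ rs) =
  hamming cur (alg q₀ hist r) + algCostFrom alg q₀ (r ∷ hist) (alg q₀ hist r) rs

algCost : ∀ {k n} → OnlineAlg k n → Config k n → List (Request k n) → ℕ
algCost alg q₀ σ = algCostFrom alg q₀ [] q₀ σ

FeasibleOffline : ∀ {k n} → List (Config k n) → List (Request k n) → Set
FeasibleOffline sol σ = Pointwise Serves sol σ

pathCost : ∀ {k n} → Config k n → List (Config k n) → ℕ
pathCost q₀ [] = 0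
pathCost q₀ (c ∷ cs) = hamming q₀ c + pathCost c cs

-- c-competitive: cost_ALG(σ) ≤ c · OPT(σ) + a for all σ and initial q₀.
-- Since OPT(σ) is the minimum of pathCost over feasible offline solutions,
-- this is stated as: ≤ c · cost(sol) + a for every feasible offline solution.
Competitive : ∀ {k n} → OnlineAlg k n → ℕ → Set
Competitive {k} {n} alg c =
  Σ ℕ λ a → (q₀ : Config k n) (σ : List (Request k n)) (sol : List (Config k n)) →
    FeasibleOffline sol σ → algCost alg q₀ σ ≤ c * pathCost q₀ sol + a

module Submission where

-- The algorithm works in phases.  It remembers the requests P of the current
-- phase; on a new request r it stays if its configuration already serves r,
-- otherwise it moves to any configuration serving every request of r ∷ P, and
-- if no such configuration exists it starts a new phase at r.
--
-- The failed configurations (p , r) of a phase form a chain: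
-- p misses r but serves every later request of the phase.  Encoding
-- configurations and requests as integer vectors of dimension 2^K whose dot
-- product is ∏ᵢ (pᵢ − rᵢ) turns a chain into a triangular system, and Gaussian
-- elimination shows a triangular system in dimension d has at most d rows.
-- Hence a phase has at most 2^K moves, each costing at most K.
--
-- No single configuration serves a phase together with the
-- request that ends it, so OPT moves at least once per finished phase.  The
-- bound is proved by a potential argument (phase-invariant) that also carries
-- a credit recording whether OPT has already paid for the current phase.

open import Defs

open import Data.Nat using (ℕ; zero; suc; _≤_; z≤n; s≤s)
open import Data.Nat.Properties using (≤-refl; ≤-trans; ≤-reflexive)
open import Data.Fin using (Fin; zero; suc)
open import Data.Fin.Properties using (any?) renaming (_≟_ to _≟ᶠ_)
open import Data.List using (List; []; _∷_; length; map)
open import Data.List.Properties using (length-map)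
open import Data.List.Relation.Unary.All as All using (All; []; _∷_; all?)
open import Data.List.Relation.Unary.All.Properties using (map⁺)
open import Data.List.Relation.Binary.Pointwise using (Pointwise; []; _∷_)
open import Data.Product using (Σ; ∃; _×_; _,_; proj₁; proj₂)
open import Data.Sum using (_⊎_; inj₁; inj₂)
open import Data.Vec using (Vec; []; _∷_; _++_; tail; zipWith)
open import Data.Empty using (⊥-elim)
open import Function using (_∘_)
open import Relation.Nullary using (¬_; Dec; yes; no)
open import Relation.Binary.PropositionalEquality
  using (_≡_; _≢_; refl; sym; trans; cong; cong₂; subst; subst₂)

-- Configurations of k servers.  Two configurations are equivalent when they
-- agree pointwise (no function extensionality is assumed).
_≈_ : ∀ {k n} → Config k n → Config k n → Set
q ≈ q′ = ∀ i → q i ≡ q′ i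

Extensional : ∀ {k n} → (Config k n → Set) → Set
Extensional P = ∀ {q q′} → q ≈ q′ → P q → P q′

rest : ∀ {k n} → Config (suc k) n → Config k (λ i → n (suc i))
rest q i = q (suc i)

_◂_ : ∀ {k} {n : Fin (suc k) → ℕ} → Fin (n zero) → Config k (λ i → n (suc i)) → Config (suc k) n
(a ◂ q) zero    = a
(a ◂ q) (suc i) = q i

◂-cong : ∀ {k} {n : Fin (suc k) → ℕ} {a : Fin (n zero)} {q q′ : Config k (λ i → n (suc i))} →
         q ≈ q′ → _≈_ {n = n} (a ◂ q) (a ◂ q′)
◂-cong eq zero    = refl
◂-cong eq (suc i) = eq i

◂-rest : ∀ {k n} (q : Config (suc k) n) → q ≈ (q zero ◂ rest q)
◂-rest q zero    = refl
◂-rest q (suc i) = refl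

search : ∀ {k n} (P : Config k n → Set) → (∀ q → Dec (P q)) → Extensional P → Dec (∃ P)
search {zero} P P? ext with P? (λ ())
... | yes p = yes (_ , p)
... | no ¬p = no λ (q , pq) → ¬p (ext (λ ()) pq)
search {suc k} {n} P P? ext
  with any? (λ a → search (P ∘ (a ◂_)) (P? ∘ (a ◂_)) (ext ∘ ◂-cong))
... | yes (a , q , p) = yes (a ◂ q , p)
... | no none = no λ (q , pq) → none (q zero , rest q , ext (◂-rest q) pq)

serves? : ∀ {k n} (q r : Config k n) → Dec (Serves q r)
serves? q r = any? (λ i → q i ≟ᶠ r i)

serves-ext : ∀ {k n} (r : Request k n) → Extensional (λ q → Serves q r)
serves-ext r eq (i , qᵢ≡rᵢ) = i , trans (sym (eq i)) qᵢ≡rᵢ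

serves-all-ext : ∀ {k n} (P : List (Request k n)) → Extensional (λ q → All (Serves q) P)
serves-all-ext P eq = All.map (λ {r} → serves-ext r eq)

module Elimination where

  open import Data.Integer using (ℤ; 0ℤ; _+_; _-_; _*_)
  open import Data.Integer.Properties using (_≟_; i*j≡0⇒i≡0∨j≡0; *-zeroʳ; +-identityˡ; +-assoc)
  open import Data.Integer.Tactic.RingSolver using (solve-∀)
  open import Data.Vec using (head) renaming (map to vmap)

  infix 8 _·_
  _·_ : ∀ {d} → Vec ℤ d → Vec ℤ d → ℤ
  [] · [] = 0ℤ
  (x ∷ xs) · (y ∷ ys) = x * y + xs · ys

  ·-++ : ∀ {m n} (a c : Vec ℤ m) (b d : Vec ℤ n) → (a ++ b) · (c ++ d) ≡ a · c + b · d
  ·-++ [] [] b d = sym (+-identityˡ (b · d))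
  ·-++ (x ∷ a) (y ∷ c) b d = trans (cong (x * y +_) (·-++ a c b d)) (sym (+-assoc (x * y) (a · c) (b · d)))

  ·-scaleˡ : ∀ {m} x (a c : Vec ℤ m) → vmap (x *_) a · c ≡ x * (a · c)
  ·-scaleˡ x [] [] = sym (*-zeroʳ x)
  ·-scaleˡ x (y ∷ a) (z ∷ c) = trans (cong (x * y * z +_) (·-scaleˡ x a c)) (ring x y z (a · c))
    where ring : ∀ x y z s → x * y * z + x * s ≡ x * (y * z + s)
          ring = solve-∀

  ·-scaleʳ : ∀ {m} x (a c : Vec ℤ m) → a · vmap (x *_) c ≡ x * (a · c)
  ·-scaleʳ x [] [] = sym (*-zeroʳ x)
  ·-scaleʳ x (y ∷ a) (z ∷ c) = trans (cong (y * (x * z) +_) (·-scaleʳ x a c)) (ring x y z (a · c))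
    where ring : ∀ x y z s → y * (x * z) + x * s ≡ x * (y * z + s)
          ring = solve-∀

  ·-tail : ∀ {d} (u w : Vec ℤ (suc d)) → head u ≡ 0ℤ → u · w ≡ tail u · tail w
  ·-tail (.0ℤ ∷ u) (y ∷ w) refl = +-identityˡ (u · w)

  combine : ∀ {d} → ℤ → Vec ℤ d → ℤ → Vec ℤ d → Vec ℤ d
  combine a v c u = zipWith (λ x y → a * x - c * y) v u

  ·-combine : ∀ {d} a c (v u w : Vec ℤ d) → combine a v c u · w ≡ a * (v · w) - c * (u · w)
  ·-combine a c [] [] [] = sym (ring a c)
    where ring : ∀ a c → a * 0ℤ - c * 0ℤ ≡ 0ℤ
          ring = solve-∀
  ·-combine a c (x ∷ v) (y ∷ u) (z ∷ w) =
    trans (cong ((a * x - c * y) * z +_) (·-combine a c v u w)) (ring a c x y z (v · w) (u · w))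
    where ring : ∀ a c x y z s t → (a * x - c * y) * z + (a * s - c * t) ≡ a * (x * z + s) - c * (y * z + t)
          ring = solve-∀

  -- v ↓ p: the row v with its first coordinate eliminated by the pivot row p
  -- (the combination head p · v − head v · p, whose leading entry vanishes).
  _↓_ : ∀ {d} → Vec ℤ (suc d) → Vec ℤ (suc d) → Vec ℤ d
  (x ∷ v) ↓ (a ∷ p) = combine a v x p

  ↓-· : ∀ {d} (v p w : Vec ℤ (suc d)) → (v ↓ p) · tail w ≡ head p * (v · w) - head v * (p · w)
  ↓-· (x ∷ v) (a ∷ p) (y ∷ w) = trans (·-combine a x v p w) (ring a x y (v · w) (p · w))
    where ring : ∀ a x y s t → a * s - x * t ≡ a * (x * y + s) - x * (a * y + t)
          ring = solve-∀

  ↓-·-orth : ∀ {d} (v p w : Vec ℤ (suc d)) → p · w ≡ 0ℤ → (v ↓ p) · tail w ≡ head p * (v · w)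
  ↓-·-orth v p w p⊥w =
    trans (↓-· v p w) (trans (cong (λ t → head p * (v · w) - head v * t) p⊥w) (ring (head p) (v · w) (head v)))
    where ring : ∀ a s x → a * s - x * 0ℤ ≡ a * s
          ring = solve-∀

  Rows : ℕ → Set
  Rows d = List (Vec ℤ d × Vec ℤ d)

  _⊥_ : ∀ {d} → Vec ℤ d → Rows d → Set
  v ⊥ L = All (λ row → v · proj₂ row ≡ 0ℤ) L

  data Triangular {d} : Rows d → Set where
    []    : Triangular []
    pivot : ∀ {v w L} → v · w ≢ 0ℤ → v ⊥ L → Triangular L → Triangular ((v , w) ∷ L)

  eliminate : ∀ {d} → Vec ℤ (suc d) → Vec ℤ (suc d) × Vec ℤ (suc d) → Vec ℤ d × Vec ℤ d
  eliminate p (v , w) = v ↓ p , tail w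

  reduce : ∀ {d} → Rows (suc d) → Rows d
  reduce [] = []
  reduce ((v , w) ∷ L) with head v ≟ 0ℤ
  ... | yes _ = (tail v , tail w) ∷ reduce L
  ... | no _  = map (eliminate v) L

  reduce-length : ∀ {d} (L : Rows (suc d)) → length L ≤ suc (length (reduce L))
  reduce-length [] = z≤n
  reduce-length ((v , w) ∷ L) with head v ≟ 0ℤ
  ... | yes _ = s≤s (reduce-length L)
  ... | no _  = ≤-reflexive (cong suc (sym (length-map (eliminate v) L)))

  ⊥-tail : ∀ {d} (u w : Vec ℤ (suc d)) → head u ≡ 0ℤ → u · w ≡ 0ℤ → tail u · tail w ≡ 0ℤ
  ⊥-tail u w u₀ u⊥w = trans (sym (·-tail u w u₀)) u⊥w

  ⊥-eliminate : ∀ {d} (u p : Vec ℤ (suc d)) {L : Rows (suc d)} → head u ≡ 0ℤ → u ⊥ L →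
                tail u ⊥ map (eliminate p) L
  ⊥-eliminate u p u₀ u⊥L = map⁺ (All.map (λ {row} → ⊥-tail u (proj₂ row) u₀) u⊥L)

  ⊥-reduce : ∀ {d} (u : Vec ℤ (suc d)) (L : Rows (suc d)) → head u ≡ 0ℤ → u ⊥ L → tail u ⊥ reduce L
  ⊥-reduce u [] u₀ [] = []
  ⊥-reduce u ((v , w) ∷ L) u₀ (u⊥w ∷ u⊥L) with head v ≟ 0ℤ
  ... | yes _ = ⊥-tail u w u₀ u⊥w ∷ ⊥-reduce u L u₀ u⊥L
  ... | no _  = ⊥-eliminate u v u₀ u⊥L

  ↓-⊥ : ∀ {d} (v p : Vec ℤ (suc d)) (L : Rows (suc d)) → v ⊥ L → p ⊥ L → (v ↓ p) ⊥ map (eliminate p) L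
  ↓-⊥ v p [] [] [] = []
  ↓-⊥ v p ((v′ , w) ∷ L) (v⊥w ∷ v⊥L) (p⊥w ∷ p⊥L) =
    trans (↓-·-orth v p w p⊥w) (trans (cong (head p *_) v⊥w) (*-zeroʳ (head p))) ∷ ↓-⊥ v p L v⊥L p⊥L

  -- Eliminating with a pivot orthogonal to all rows keeps the system
  -- triangular: head p ≠ 0 and v · w ≠ 0 give head p · (v · w) ≠ 0.
  eliminate-triangular : ∀ {d} (p : Vec ℤ (suc d)) {L : Rows (suc d)} → head p ≢ 0ℤ → p ⊥ L →
                         Triangular L → Triangular (map (eliminate p) L)
  eliminate-triangular p p≢0 [] [] = []
  eliminate-triangular p p≢0 (p⊥w ∷ p⊥L) (pivot {v} {w} {L} v·w≢0 v⊥L tri) =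
    pivot nonzero (↓-⊥ v p L v⊥L p⊥L) (eliminate-triangular p p≢0 p⊥L tri)
    where
    nonzero : (v ↓ p) · tail w ≢ 0ℤ
    nonzero eq with i*j≡0⇒i≡0∨j≡0 (head p) (trans (sym (↓-·-orth v p w p⊥w)) eq)
    ... | inj₁ p≡0   = p≢0 p≡0
    ... | inj₂ v·w≡0 = v·w≢0 v·w≡0

  reduce-triangular : ∀ {d} {L : Rows (suc d)} → Triangular L → Triangular (reduce L)
  reduce-triangular [] = []
  reduce-triangular (pivot {v} {w} {L} v·w≢0 v⊥L tri) with head v ≟ 0ℤ
  ... | yes v₀  = pivot (v·w≢0 ∘ trans (·-tail v w v₀)) (⊥-reduce v L v₀ v⊥L) (reduce-triangular tri)
  ... | no v≢0 = eliminate-triangular v v≢0 v⊥L tri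

  triangular-length : ∀ {d} {L : Rows d} → Triangular L → length L ≤ d
  triangular-length {zero} [] = z≤n
  triangular-length {zero} (pivot {[]} {[]} 0≢0 _ _) = ⊥-elim (0≢0 refl)
  triangular-length {suc d} {L} tri =
    ≤-trans (reduce-length L) (s≤s (triangular-length (reduce-triangular tri)))

-- Configurations and requests as integer vectors of dimension 2^k whose dot
-- product is ∏ᵢ (pᵢ − rᵢ); it vanishes exactly when p serves r.
module Encoding where

  open Elimination using (_·_; ·-++; ·-scaleˡ; ·-scaleʳ)
  open import Data.Integer using (ℤ; 0ℤ; 1ℤ; +_; -_; _+_; _-_; _*_)
  open import Data.Integer.Properties using (i*j≡0⇒i≡0∨j≡0; i-j≡0⇒i≡j; i≡j⇒i-j≡0; +-injective; *-zeroʳ)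
  open import Data.Integer.Tactic.RingSolver using (solve-∀)
  open import Data.Fin using (toℕ)
  open import Data.Fin.Properties using (toℕ-injective)
  open import Data.Vec using () renaming (map to vmap)
  open import Relation.Binary.PropositionalEquality using (module ≡-Reasoning)
  import Data.Nat as ℕ
  open import Data.Nat.Properties using (+-identityʳ)

  dim : ℕ → ℕ
  dim zero    = 1
  dim (suc k) = dim k ℕ.+ dim k

  dim≡2^ : ∀ k → dim k ≡ 2 ℕ.^ k
  dim≡2^ zero    = refl
  dim≡2^ (suc k) = cong₂ ℕ._+_ (dim≡2^ k) (trans (dim≡2^ k) (sym (+-identityʳ (2 ℕ.^ k))))

  coord : ∀ {m} → Fin m → ℤ
  coord x = + toℕ x

  -- configVec p = ⊗ᵢ (1 , pᵢ) and requestVec r = ⊗ᵢ (−rᵢ , 1).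
  configVec : ∀ {k n} → Config k n → Vec ℤ (dim k)
  configVec {zero}  p = 1ℤ ∷ []
  configVec {suc k} p = configVec (rest p) ++ vmap (coord (p zero) *_) (configVec (rest p))

  requestVec : ∀ {k n} → Request k n → Vec ℤ (dim k)
  requestVec {zero}  r = 1ℤ ∷ []
  requestVec {suc k} r = vmap (- coord (r zero) *_) (requestVec (rest r)) ++ requestVec (rest r)

  ·-factor : ∀ {k n} (p r : Config (suc k) n) →
             configVec p · requestVec r ≡ (coord (p zero) - coord (r zero)) * (configVec (rest p) · requestVec (rest r))
  ·-factor p r = begin
      configVec p · requestVec r
    ≡⟨ ·-++ v (vmap (- x *_) w) (vmap (y *_) v) w ⟩
      v · vmap (- x *_) w + vmap (y *_) v · w
    ≡⟨ cong₂ _+_ (·-scaleʳ (- x) v w) (·-scaleˡ y v w) ⟩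
      - x * (v · w) + y * (v · w)
    ≡⟨ ring x y (v · w) ⟩
      (y - x) * (v · w)
    ∎
    where
    open ≡-Reasoning
    v = configVec (rest p)
    w = requestVec (rest r)
    x = coord (r zero)
    y = coord (p zero)
    ring : ∀ x y s → - x * s + y * s ≡ (y - x) * s
    ring = solve-∀

  serves⇒orthogonal : ∀ {k n} (p r : Config k n) → Serves p r → configVec p · requestVec r ≡ 0ℤ
  serves⇒orthogonal {suc k} p r (zero , p₀≡r₀) =
    trans (·-factor p r) (cong (_* (configVec (rest p) · requestVec (rest r))) (i≡j⇒i-j≡0 (cong coord p₀≡r₀)))
  serves⇒orthogonal {suc k} p r (suc i , pᵢ≡rᵢ) =
    trans (·-factor p r) (trans (cong (d₀ *_) (serves⇒orthogonal (rest p) (rest r) (i , pᵢ≡rᵢ))) (*-zeroʳ d₀))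
    where d₀ = coord (p zero) - coord (r zero)

  orthogonal⇒serves : ∀ {k n} (p r : Config k n) → configVec p · requestVec r ≡ 0ℤ → Serves p r
  orthogonal⇒serves {zero} p r ()
  orthogonal⇒serves {suc k} p r p⊥r
    with i*j≡0⇒i≡0∨j≡0 (coord (p zero) - coord (r zero)) (trans (sym (·-factor p r)) p⊥r)
  ... | inj₁ p₀-r₀≡0 = zero , toℕ-injective (+-injective (i-j≡0⇒i≡j _ _ p₀-r₀≡0))
  ... | inj₂ rest⊥   = let (i , pᵢ≡rᵢ) = orthogonal⇒serves (rest p) (rest r) rest⊥ in suc i , pᵢ≡rᵢ

open Elimination using (Triangular; []; pivot; triangular-length)
open Encoding using (configVec; requestVec; serves⇒orthogonal; orthogonal⇒serves; dim≡2^)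

open import Data.Nat using (_+_; _*_; _^_)
open import Data.Nat.Properties
  using (+-identityʳ; *-identityˡ; +-comm; *-comm; *-suc; +-mono-≤; +-monoˡ-≤; +-monoʳ-≤;
         *-monoʳ-≤; *-monoˡ-≤; m≤m+n; m≤n+m; m≤m*n; n≤1+n; module ≤-Reasoning)
open import Data.Nat.Tactic.RingSolver using (solve-∀)

-- A chain: each configuration misses its own request but serves the
-- requests of all later links.  The failed positions of a phase form a chain.
data Chain {k n} : List (Config k n × Request k n) → Set where
  []   : Chain []
  link : ∀ {p r L} → ¬ Serves p r → All (Serves p ∘ proj₂) L → Chain L → Chain ((p , r) ∷ L)

chain⇒triangular : ∀ {k n} {L : List (Config k n × Request k n)} →
                   Chain L → Triangular (map (λ (p , r) → configVec p , requestVec r) L)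
chain⇒triangular [] = []
chain⇒triangular (link {p} {r} misses serves chain) =
  pivot (misses ∘ orthogonal⇒serves p r)
        (map⁺ (All.map (λ {(_ , r′)} → serves⇒orthogonal p r′) serves))
        (chain⇒triangular chain)

chain-length : ∀ {k n} {L : List (Config k n × Request k n)} → Chain L → length L ≤ 2 ^ k
chain-length {k} {L = L} chain =
  subst₂ _≤_ (length-map _ L) (dim≡2^ k) (triangular-length (chain⇒triangular chain))

hamming-≤ : ∀ {k n} (q q′ : Config k n) → hamming q q′ ≤ k
hamming-≤ {zero}  q q′ = z≤n
hamming-≤ {suc k} q q′ with q zero ≟ᶠ q′ zero
... | yes _ = ≤-trans (hamming-≤ (rest q) (rest q′)) (n≤1+n k)
... | no _  = s≤s (hamming-≤ (rest q) (rest q′))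

hamming-self : ∀ {k n} (q : Config k n) → hamming q q ≡ 0
hamming-self {zero}  q = refl
hamming-self {suc k} q with q zero ≟ᶠ q zero
... | yes _ = hamming-self (rest q)
... | no q₀≢q₀ = ⊥-elim (q₀≢q₀ refl)

hamming-zero : ∀ {k n} (q q′ : Config k n) → hamming q q′ ≡ 0 → q ≈ q′
hamming-zero {suc k} q q′ h≡0 i with q zero ≟ᶠ q′ zero
hamming-zero {suc k} q q′ h≡0 zero    | yes q₀≡q′₀ = q₀≡q′₀
hamming-zero {suc k} q q′ h≡0 (suc i) | yes _      = hamming-zero (rest q) (rest q′) h≡0 i

Coverable : ∀ {k n} → List (Request k n) → Set
Coverable {k} {n} P = ∃ λ (q : Config k n) → All (Serves q) P

coverable? : ∀ {k n} (P : List (Request k n)) → Dec (Coverable P)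
coverable? P = search (λ q → All (Serves q) P) (λ q → all? (serves? q) P) (serves-all-ext P)

-- The algorithm's state: its configuration and the requests of the current phase.
State : (k : ℕ) → (Fin k → ℕ) → Set
State k n = Config k n × List (Request k n)

step : ∀ {k n} → State k n → Request k n → State k n
step (cur , P) r with serves? cur r
... | yes _ = cur , r ∷ P
... | no _ with coverable? (r ∷ P)
...   | yes (q , _) = q , r ∷ P
...   | no _        = r , r ∷ []

step-serves : ∀ {k n} (s : State (suc k) n) (r : Request (suc k) n) → Serves (proj₁ (step s r)) r
step-serves (cur , P) r with serves? cur r
... | yes cur-serves = cur-serves
... | no _ with coverable? (r ∷ P)
...   | yes (q , q-serves ∷ _) = q-serves
...   | no _                   = zero , refl

run : ∀ {k n} → Config k n → List (Request k n) → State k n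
run q₀ []         = q₀ , []
run q₀ (r ∷ hist) = step (run q₀ hist) r

algorithm : ∀ {k n} → OnlineAlg k n
algorithm q₀ hist r = proj₁ (step (run q₀ hist) r)

costFrom : ∀ {k n} → State k n → List (Request k n) → ℕ
costFrom s []       = 0
costFrom s (r ∷ rs) = hamming (proj₁ s) (proj₁ (step s r)) + costFrom (step s r) rs

algCostFrom≡costFrom : ∀ {k n} (q₀ : Config k n) hist σ →
  algCostFrom algorithm q₀ hist (proj₁ (run q₀ hist)) σ ≡ costFrom (run q₀ hist) σ
algCostFrom≡costFrom q₀ hist []       = refl
algCostFrom≡costFrom q₀ hist (r ∷ rs) = cong (_ +_) (algCostFrom≡costFrom q₀ (r ∷ hist) rs)

regroup : ∀ h x m → h + x + m ≡ x + (h + m)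
regroup = solve-∀

-- An offline move of at least one unit pays c.
moved-pays : ∀ c h p e → c * p + c + c ≤ c * (suc h + p) + c + e
moved-pays c h p e = begin
    c * p + c + c         ≤⟨ +-monoˡ-≤ c (+-mono-≤ (*-monoʳ-≤ c (m≤n+m p h)) ≤-refl) ⟩
    c * (h + p) + c + c   ≡⟨ cong (_+ c) (sym (trans (*-suc c (h + p)) (+-comm c (c * (h + p))))) ⟩
    c * (suc h + p) + c   ≤⟨ m≤m+n _ e ⟩
    c * (suc h + p) + c + e ∎
  where open ≤-Reasoning

-- A move of at most K within a phase is absorbed by one more link at K.
move-absorbed : ∀ {h K} x m → h ≤ K → h + x + m ≤ x + (K + m)
move-absorbed {h} {K} x m h≤K = begin
    h + x + m   ≡⟨ regroup h x m ⟩
    x + (h + m) ≤⟨ +-monoʳ-≤ x (+-monoˡ-≤ m h≤K) ⟩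
    x + (K + m) ∎
  where open ≤-Reasoning

-- Closing a phase: the phase's cost h + m is at most c, which the offline
-- movement b plus the credit e pay for.
phase-closed : ∀ h x m {a b c e} → x ≤ a + c → h + m ≤ c → c ≤ b + e → h + x + m ≤ (a + c) + (b + e)
phase-closed h x m x≤ h+m≤c c≤b+e = begin
    h + x + m   ≡⟨ regroup h x m ⟩
    x + (h + m) ≤⟨ +-mono-≤ x≤ (≤-trans h+m≤c c≤b+e) ⟩
    _           ∎
  where open ≤-Reasoning

module Analysis {k : ℕ} {n : Fin (suc k) → ℕ} where

  K : ℕ
  K = suc k

  ratio : ℕ
  ratio = K * 2 ^ K

  Covers : List (Request K n) → List (Config K n × Request K n) → Set
  Covers P M = ∀ q → All (Serves q) P → All (Serves q ∘ proj₂) M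

  -- Credit e of OPT at o during phase P: either e is a full ratio, or o
  -- serves the whole phase so far (so OPT still has to move before it ends).
  Credit : Config K n → List (Request K n) → ℕ → Set
  Credit o P e = ratio ≤ e ⊎ All (Serves o) P

  chain-charge : ∀ {M : List (Config K n × Request K n)} → Chain M → length M * K ≤ ratio
  chain-charge {M} chain = begin
      length M * K ≤⟨ *-monoˡ-≤ K (chain-length chain) ⟩
      2 ^ K * K    ≡⟨ *-comm (2 ^ K) K ⟩
      ratio        ∎
    where open ≤-Reasoning

  -- When OPT moves from o to o′ serving r, the credit carries over to the
  -- extended phase; if OPT really moved, its movement pays a fresh ratio.
  credit-step : ∀ {o o′ : Config K n} {P r e} p → Credit o P e → Serves o′ r →
    Σ ℕ λ e′ → Credit o′ (r ∷ P) e′ × ratio * p + ratio + e′ ≤ ratio * (hamming o o′ + p) + ratio + e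
  credit-step {o} {o′} {P} {r} {e} p credit o′-serves with hamming o o′ in moved
  ... | zero  = e , carried credit , ≤-refl
    where
    carried : Credit o P e → Credit o′ (r ∷ P) e
    carried (inj₁ ratio≤e) = inj₁ ratio≤e
    carried (inj₂ o-serves) = inj₂ (o′-serves ∷ serves-all-ext P (hamming-zero o o′ moved) o-serves)
  ... | suc h = ratio , inj₁ ≤-refl , moved-pays ratio h p e

  -- A phase ends only when no configuration serves it together with r;
  -- then OPT has paid a ratio, either earlier (credit) or by moving now.
  phase-end-paid : ∀ {o o′ : Config K n} {P r e} → Credit o P e → Serves o′ r → ¬ Coverable (r ∷ P) →
                   ratio ≤ ratio * hamming o o′ + e
  phase-end-paid (inj₁ ratio≤e) _ _ = ≤-trans ratio≤e (m≤n+m _ _)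
  phase-end-paid {o} {o′} {P} (inj₂ o-serves) o′-serves uncoverable with hamming o o′ in moved
  ... | zero  = ⊥-elim (uncoverable (o′ , o′-serves ∷ serves-all-ext P (hamming-zero o o′ moved) o-serves))
  ... | suc h = ≤-trans (m≤m*n ratio (suc h)) (m≤m+n _ _)

  -- The potential argument: the remaining cost of the algorithm plus K per
  -- link of the current chain M is at most ratio · OPT + ratio + credit.
  phase-invariant : ∀ σ sol (cur : Config K n) P M o e →
    All (Serves cur) P → Covers P M → Chain M → Credit o P e → Pointwise Serves sol σ →
    costFrom (cur , P) σ + length M * K ≤ ratio * pathCost o sol + ratio + e
  phase-invariant [] [] cur P M o e _ _ chain _ [] =
    ≤-trans (chain-charge chain) (≤-trans (m≤n+m ratio (ratio * 0)) (m≤m+n _ e))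
  phase-invariant (r ∷ rs) (o′ ∷ sol) cur P M o e cur-serves covers chain credit (o′-serves ∷ feasible)
    with serves? cur r
  ... | yes serves-r rewrite hamming-self cur =
    let (e′ , credit′ , paid) = credit-step (pathCost o′ sol) credit o′-serves in
    ≤-trans (phase-invariant rs sol cur (r ∷ P) M o′ e′ (serves-r ∷ cur-serves)
                             (λ q → covers q ∘ All.tail) chain credit′ feasible)
            paid
  ... | no misses-r with coverable? (r ∷ P)
  ...   | yes (q , q-serves) =
    let (e′ , credit′ , paid) = credit-step (pathCost o′ sol) credit o′-serves in
    ≤-trans (move-absorbed _ _ (hamming-≤ cur q))
    (≤-trans (phase-invariant rs sol q (r ∷ P) ((cur , r) ∷ M) o′ e′ q-serves
                              (λ q′ serves → All.head serves ∷ covers q′ (All.tail serves))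
                              (link misses-r (covers cur cur-serves) chain) credit′ feasible)
             paid)
  ...   | no uncoverable = begin
      hamming cur r + X + length M * K
    ≤⟨ phase-closed (hamming cur r) X (length M * K) {a = ratio * p} {b = ratio * hamming o o′}
                    X≤ phase-cost (phase-end-paid credit o′-serves uncoverable) ⟩
      (ratio * p + ratio) + (ratio * hamming o o′ + e)
    ≡⟨ regroup′ ratio p (hamming o o′) e ⟩
      ratio * (hamming o o′ + p) + ratio + e
    ∎
    where
    open ≤-Reasoning
    X = costFrom (r , r ∷ []) rs
    p = pathCost o′ sol
    X≤ : X ≤ ratio * p + ratio
    X≤ = subst₂ _≤_ (+-identityʳ X) (+-identityʳ _)
           (phase-invariant rs sol r (r ∷ []) [] o′ 0 ((zero , refl) ∷ []) (λ _ _ → []) [] (inj₂ (o′-serves ∷ [])) feasible)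
    phase-cost : hamming cur r + length M * K ≤ ratio
    phase-cost = ≤-trans (+-monoˡ-≤ (length M * K) (hamming-≤ cur r))
                         (chain-charge (link misses-r (covers cur cur-serves) chain))
    regroup′ : ∀ c p h e → (c * p + c) + (c * h + e) ≡ c * (h + p) + c + e
    regroup′ = solve-∀

  competitive : ∀ q₀ σ sol → FeasibleOffline sol σ → algCost algorithm q₀ σ ≤ ratio * pathCost q₀ sol + ratio
  competitive q₀ σ sol feasible =
    subst₂ _≤_ (trans (+-identityʳ _) (sym (algCostFrom≡costFrom q₀ [] σ))) (+-identityʳ _)
           (phase-invariant σ sol q₀ [] [] q₀ 0 [] (λ _ _ → []) [] (inj₂ []) feasible)

open Analysis using (ratio; competitive)

theorem1 : Σ ℕ λ C → (k : ℕ) (n : Fin (suc k) → ℕ) →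
    Σ (OnlineAlg (suc k) n) λ alg →
      ValidAlg alg × Competitive alg (C * (suc k * 2 ^ suc k))
theorem1 = 1 , λ k n →
  algorithm ,
  (λ q₀ hist r → step-serves (run q₀ hist) r) ,
  ratio {k} {n} ,
  λ q₀ σ sol feasible →
    subst (λ c → algCost algorithm q₀ σ ≤ c * pathCost q₀ sol + ratio {k} {n})
          (sym (*-identityˡ (ratio {k} {n})))
          (competitive q₀ σ sol feasible)
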